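{- Let $n\ge 4$ and let $\mathcal{T}$ be a set of transpositions of $Sym(n)$ such that the graph $G(\mathcal{T})$ is a unicyclic triangle-free graph, and let $UG_n=Cay(Sym(n),\mathcal{T})$. Then $\kappa_c(UG_n)\le 4n-8$.
   Context: $Sym(n)$ is the symmetric group on $[n]=\{1,\dots,n\}$. For a set $\mathcal{T}$ of transpositions of $Sym(n)$, $G(\mathcal{T})$ is the graph with vertex set $[n]$ and edge set $\{ij: (i\,j)\in\mathcal{T}\}$. A unicyclic triangle-free graph is a connected graph containing exactly one cycle, this cycle having length at least $4$. The Cayley graph $Cay(Sym(n),\mathcal{T})$ is the undirected graph with vertex set $Sym(n)$ in which $g$ and $g\cdot t$ are adjacent for all $g\in Sym(n)$, $t\in\mathcal{T}$. For a graph $G$, the cyclic connectivity $\kappa_c(G)$ is the minimum cardinality of a vertex set $S\subseteq V(G)$ such that $G-S$ is disconnected and at least two components of $G-S$ contain a cycle. -}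

module Defs where

open import Level using (Level; _⊔_)
open import Data.Nat using (ℕ; _≤_; _∸_; _*_)
open import Data.Fin using (Fin)
open import Data.Fin.Permutation.Components using (transpose)
open import Data.Vec using (Vec; lookup; tabulate)
open import Data.List using (List; []; _∷_; _++_; zip; length)
open import Data.List.Membership.Propositional using (_∈_; _∉_)
open import Data.List.Relation.Unary.All using (All)
open import Data.List.Relation.Unary.Unique.Propositional using (Unique)
open import Data.List.Relation.Unary.Linked using (Linked)
open import Data.Product using (Σ; ∃; ∃-syntax; _×_; _,_)
open import Data.Sum using (_⊎_)
open import Data.Empty using (⊥)
open import Data.Unit using (⊤)
open import Function.Bundles using (_⇔_)
open import Relation.Nullary using (¬_)
open import Relation.Binary.PropositionalEquality using (_≡_; _≢_)
open import Relation.Binary.Construct.Closure.ReflexiveTransitive using (Star)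

-- Generic (simple, undirected) graphs on a vertex type V, given by an
-- adjacency relation E, restricted to the vertices satisfying A
-- (A is used to delete vertices: G - S has A v = "v ∈ V(G) and v ∉ S").

module Generic {V : Set} where

  Restrict : (E : V → V → Set) (A : V → Set) → V → V → Set
  Restrict E A x y = A x × A y × E x y

  Reach : (E : V → V → Set) (A : V → Set) → V → V → Set
  Reach E A u v = A u × Star (Restrict E A) u v

  Connected : (E : V → V → Set) (A : V → Set) → Set
  Connected E A = ∀ u v → A u → A v → Reach E A u v

  ClosedWalk : (E : V → V → Set) → List V → Set
  ClosedWalk E [] = ⊥
  ClosedWalk E (x ∷ xs) = Linked E (x ∷ xs ++ x ∷ [])

  IsCycle : (E : V → V → Set) (A : V → Set) → List V → Set
  IsCycle E A c = 3 ≤ length c × Unique c × All A c × ClosedWalk E c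

  cycleEdges : List V → List (V × V)
  cycleEdges [] = []
  cycleEdges (x ∷ xs) = zip (x ∷ xs) (xs ++ x ∷ [])

  EdgeOfCycle : List V → V → V → Set
  EdgeOfCycle c x y = ((x , y) ∈ cycleEdges c) ⊎ ((y , x) ∈ cycleEdges c)

  SameCycle : List V → List V → Set
  SameCycle c d = ∀ x y → EdgeOfCycle c x y ⇔ EdgeOfCycle d x y

open Generic public

-- Graph G(𝒯) of a set of transpositions of Sym(n).
-- A set of transpositions is given as a list of pairs (i , j) with i ≢ j,
-- the pair (i , j) standing for the transposition (i j).

Transpositions : ℕ → Set
Transpositions n = List (Fin n × Fin n)

ValidTranspositions : ∀ {n} → Transpositions n → Set
ValidTranspositions 𝒯 = All (λ { (i , j) → i ≢ j }) 𝒯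

GT-Edge : ∀ {n} → Transpositions n → Fin n → Fin n → Set
GT-Edge 𝒯 i j = ((i , j) ∈ 𝒯) ⊎ ((j , i) ∈ 𝒯)

AllVertices : ∀ {n} → Fin n → Set
AllVertices _ = ⊤

-- G is a unicyclic triangle-free graph: connected, containing exactly one
-- cycle (up to its edge set), and this cycle has length at least 4
UnicyclicTriangleFree : ∀ {n} → Transpositions n → Set
UnicyclicTriangleFree 𝒯 =
  Connected (GT-Edge 𝒯) AllVertices ×
  Σ (List _) (λ c → IsCycle (GT-Edge 𝒯) AllVertices c × 4 ≤ length c ×
     (∀ d → IsCycle (GT-Edge 𝒯) AllVertices d → SameCycle c d))

-- Sym(n): a permutation g is represented by its table
-- (g(0), …, g(n-1)) : Vec (Fin n) n, required to be injective.

IsPerm : ∀ {n} → Vec (Fin n) n → Set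
IsPerm {n} g = ∀ (x y : Fin n) → lookup g x ≡ lookup g y → x ≡ y

-- product g · (i j) (first apply (i j), then g): (g·t)(k) = g(t(k))
_·swap_ : ∀ {n} → Vec (Fin n) n → Fin n × Fin n → Vec (Fin n) n
g ·swap (i , j) = tabulate (λ k → lookup g (transpose i j k))

Cay-Edge : ∀ {n} → Transpositions n → Vec (Fin n) n → Vec (Fin n) n → Set
Cay-Edge 𝒯 g h = Σ _ (λ t → t ∈ 𝒯 × h ≡ g ·swap t)

module Cuts {V : Set} where

  Minus : (A : V → Set) → List V → V → Set
  Minus A S v = A v × v ∉ S

  ComponentHasCycle : (E : V → V → Set) (A : V → Set) → V → Set
  ComponentHasCycle E A u = Σ (List V) (λ c → IsCycle E A c × All (Reach E A u) c)

  IsCyclicCut : (E : V → V → Set) (A : V → Set) → List V → Set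
  IsCyclicCut E A S =
    Unique S × All A S ×
    Σ V (λ u → Σ V (λ v →
      Minus A S u × Minus A S v × ¬ Reach E (Minus A S) u v ×
      ComponentHasCycle E (Minus A S) u × ComponentHasCycle E (Minus A S) v))

  CyclicConnectivity≤ : (E : V → V → Set) (A : V → Set) → ℕ → Set
  CyclicConnectivity≤ E A k = Σ (List V) (λ S → IsCyclicCut E A S × length S ≤ k)

open Cuts public

-- Take two disjoint edges ab and cd of the cycle of G(𝒯), which exist as the cycle has length at least 4.
-- The transpositions t₁ = (a b) and t₂ = (c d) commute, so every g lies on the 4-cycle g, g t₁, g t₁ t₂, g t₂
-- of the Cayley graph. Let S consist of the neighbours of the 4-cycle Q through the identity along the other
-- transpositions of 𝒯, outside Q; then Q is a union of components of the graph minus S. The 4-cycle through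
-- (a c)(b d) avoids S: its vertices map {a, b} onto {c, d}, those of Q map {a, b} onto itself, and right
-- multiplication by one transposition changes a permutation at two points only, not at all of a, b, c.
-- Finally every cycle of G(𝒯) uses ab, so the edges other than ab form a forest on n vertices; hence
-- there are at most n − 2 transpositions besides (a b) and (c d), and |S| ≤ 4(n − 2).

module Submission where

open import Defs
open import Data.Nat using (ℕ; suc; _≤_; _<_; _+_; _*_; _∸_; z≤n; s≤s)
open import Data.Nat.Properties
  using (≤-trans; ≤-reflexive; m≤n+m; +-identityʳ; +-suc; +-monoˡ-≤; m+n∸m≡n; *-distribˡ-+; *-monoʳ-≤; ∸-monoˡ-≤;
         module ≤-Reasoning)
open import Data.Fin using (Fin; _≟_)
open import Data.Fin.Permutation.Components using (transpose; transpose-inverse)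
open import Data.Fin.Subset using (Subset; ⊤; _-_; ∣_∣) renaming (_∈_ to _∈ₛ_)
open import Data.Fin.Subset.Properties using (∈⊤; ∣⊤∣≡n; x∈p∧x≢y⇒x∈p-y; x∈p⇒∣p-x∣<∣p∣)
open import Data.Vec using (Vec; lookup; allFin)
open import Data.Vec.Properties using (lookup∘tabulate; tabulate∘lookup; tabulate-cong; lookup-allFin; ≡-dec)
open import Data.List using (List; []; _∷_; _++_; length; map; zip; filter; deduplicate; cartesianProductWith)
open import Data.List.Properties using (++-assoc; length-++; length-map; length-filter; length-deduplicate)
open import Data.List.Membership.Propositional using (_∈_; _∉_; find)
open import Data.List.Membership.Propositional.Properties
  using (∈-++⁻; ∈-∃++; ∈-filter⁺; ∈-filter⁻; ∈-deduplicate⁺; ∈-deduplicate⁻;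
         ∈-cartesianProductWith⁺; ∈-cartesianProductWith⁻)
import Data.List.Membership.DecPropositional as DecMembership
open import Data.List.Relation.Unary.Any using (Any; here; there)
import Data.List.Relation.Unary.Any as Any
import Data.List.Relation.Unary.Any.Properties as Any
open import Data.List.Relation.Unary.All as All using (All; []; _∷_)
open import Data.List.Relation.Unary.All.Properties using (¬Any⇒All¬)
open import Data.List.Relation.Unary.AllPairs using (AllPairs; []; _∷_)
open import Data.List.Relation.Unary.Unique.Propositional using (Unique)
open import Data.List.Relation.Unary.Unique.Propositional.Properties using (filter⁺)
import Data.List.Relation.Unary.Unique.DecPropositional.Properties as DecUnique
open import Data.List.Relation.Unary.Unique.DecSetoid.Properties using (deduplicate-!)
open import Data.List.Relation.Unary.Linked as Linked using (Linked; []; [-]; _∷_)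
open import Data.Product using (Σ; ∃; ∃₂; _×_; _,_; proj₁; proj₂)
open import Data.Sum as Sum using (_⊎_; inj₁; inj₂; [_,_]′)
open import Data.Empty using (⊥; ⊥-elim)
open import Function using (_∘_; id)
open import Function.Bundles using (Equivalence)
open import Relation.Nullary using (¬_; ¬?; Dec; yes; no)
open import Relation.Nullary.Decidable using (dec-true; dec-false; _×-dec_; _⊎-dec_)
open import Relation.Binary.Bundles using (DecSetoid)
open import Relation.Binary.Definitions using (DecidableEquality)
open import Relation.Binary.Construct.Closure.ReflexiveTransitive as Star using (Star; ε; _◅_; _◅◅_)
open import Relation.Binary.PropositionalEquality

module _ {n : ℕ} where

  transpose-matchˡ : (i j : Fin n) → transpose i j i ≡ j
  transpose-matchˡ i j rewrite dec-true (i ≟ i) refl = refl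

  transpose-matchʳ : (i j : Fin n) → transpose i j j ≡ i
  transpose-matchʳ i j with j ≟ i
  ... | yes j≡i = j≡i
  ... | no _ rewrite dec-true (j ≟ j) refl = refl

  transpose-other : {i j k : Fin n} → k ≢ i → k ≢ j → transpose i j k ≡ k
  transpose-other {i} {j} {k} k≢i k≢j rewrite dec-false (k ≟ i) k≢i | dec-false (k ≟ j) k≢j = refl

  endpoint-cases : (i j k : Fin n) → k ≡ i ⊎ (k ≢ i × k ≡ j) ⊎ (k ≢ i × k ≢ j)
  endpoint-cases i j k with k ≟ i | k ≟ j
  ... | yes k≡i | _       = inj₁ k≡i
  ... | no k≢i  | yes k≡j = inj₂ (inj₁ (k≢i , k≡j))
  ... | no k≢i  | no k≢j  = inj₂ (inj₂ (k≢i , k≢j))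

  transpose-sym : (i j k : Fin n) → transpose i j k ≡ transpose j i k
  transpose-sym i j k with endpoint-cases i j k
  ... | inj₁ refl               = trans (transpose-matchˡ k j) (sym (transpose-matchʳ j k))
  ... | inj₂ (inj₁ (_ , refl))  = trans (transpose-matchʳ i k) (sym (transpose-matchˡ k i))
  ... | inj₂ (inj₂ (k≢i , k≢j)) = trans (transpose-other k≢i k≢j) (sym (transpose-other k≢j k≢i))

  transpose-involutive : (i j k : Fin n) → transpose i j (transpose i j k) ≡ k
  transpose-involutive i j k = trans (cong (transpose i j) (transpose-sym i j k)) (transpose-inverse i j)

  transpose-injective : (i j : Fin n) {k l : Fin n} → transpose i j k ≡ transpose i j l → k ≡ l
  transpose-injective i j {k} {l} eq =
    trans (sym (transpose-involutive i j k)) (trans (cong (transpose i j) eq) (transpose-involutive i j l))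

  transpose-conjugate : (f : Fin n → Fin n) → (∀ {k l} → f k ≡ f l → k ≡ l) →
                        ∀ i j k → f (transpose i j k) ≡ transpose (f i) (f j) (f k)
  transpose-conjugate f f-inj i j k with endpoint-cases i j k
  ... | inj₁ refl               = trans (cong f (transpose-matchˡ k j)) (sym (transpose-matchˡ (f k) (f j)))
  ... | inj₂ (inj₁ (_ , refl))  = trans (cong f (transpose-matchʳ i k)) (sym (transpose-matchʳ (f i) (f k)))
  ... | inj₂ (inj₂ (k≢i , k≢j)) =
    trans (cong f (transpose-other k≢i k≢j)) (sym (transpose-other (k≢i ∘ f-inj) (k≢j ∘ f-inj)))

module _ {n : ℕ} where

  _∈ᵗ_ : Fin n → Fin n × Fin n → Set
  x ∈ᵗ (i , j) = x ≡ i ⊎ x ≡ j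

  _∈ᵗ?_ : (x : Fin n) (t : Fin n × Fin n) → Dec (x ∈ᵗ t)
  x ∈ᵗ? (i , j) = (x ≟ i) ⊎-dec (x ≟ j)

  three-endpoints : ∀ {x y z i j : Fin n} → x ≢ y → x ≢ z → y ≢ z →
                    x ∈ᵗ (i , j) → y ∈ᵗ (i , j) → z ∈ᵗ (i , j) → ⊥
  three-endpoints x≢y _   _   (inj₁ refl) (inj₁ refl) _           = x≢y refl
  three-endpoints x≢y _   _   (inj₂ refl) (inj₂ refl) _           = x≢y refl
  three-endpoints _   x≢z _   (inj₁ refl) (inj₂ refl) (inj₁ refl) = x≢z refl
  three-endpoints _   _   y≢z (inj₁ refl) (inj₂ refl) (inj₂ refl) = y≢z refl
  three-endpoints _   _   y≢z (inj₂ refl) (inj₁ refl) (inj₁ refl) = y≢z refl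
  three-endpoints _   x≢z _   (inj₂ refl) (inj₁ refl) (inj₂ refl) = x≢z refl

  Disjointᵗ : Fin n × Fin n → Fin n × Fin n → Set
  Disjointᵗ s t = ∀ {x} → x ∈ᵗ s → x ∈ᵗ t → ⊥

  disjointᵗ : ∀ {a b c d} → a ≢ c → a ≢ d → b ≢ c → b ≢ d → Disjointᵗ (a , b) (c , d)
  disjointᵗ a≢c _   _   _   (inj₁ refl) (inj₁ refl) = a≢c refl
  disjointᵗ _   a≢d _   _   (inj₁ refl) (inj₂ refl) = a≢d refl
  disjointᵗ _   _   b≢c _   (inj₂ refl) (inj₁ refl) = b≢c refl
  disjointᵗ _   _   _   b≢d (inj₂ refl) (inj₂ refl) = b≢d refl

  Disjointᵗ-sym : ∀ {s t} → Disjointᵗ s t → Disjointᵗ t s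
  Disjointᵗ-sym s#t x∈t x∈s = s#t x∈s x∈t

  transpose-fixes-disjoint : ∀ {s i j x} → Disjointᵗ s (i , j) → x ∈ᵗ s → transpose i j x ≡ x
  transpose-fixes-disjoint s#t x∈s = transpose-other (λ x≡i → s#t x∈s (inj₁ x≡i)) (λ x≡j → s#t x∈s (inj₂ x≡j))

  ∈ᵗ-transpose-self : ∀ {i j x} → x ∈ᵗ (i , j) → transpose i j x ∈ᵗ (i , j)
  ∈ᵗ-transpose-self {i} {j} (inj₁ refl) = inj₂ (transpose-matchˡ i j)
  ∈ᵗ-transpose-self {i} {j} (inj₂ refl) = inj₁ (transpose-matchʳ i j)

  ∈ᵗ-transpose-disjoint : ∀ {s i j x} → Disjointᵗ s (i , j) → x ∈ᵗ s → transpose i j x ∈ᵗ s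
  ∈ᵗ-transpose-disjoint {s} s#t x∈s = subst (_∈ᵗ s) (sym (transpose-fixes-disjoint s#t x∈s)) x∈s

  transpose-commute : ∀ {a b c d} → Disjointᵗ (a , b) (c , d) → ∀ k →
                      transpose a b (transpose c d k) ≡ transpose c d (transpose a b k)
  transpose-commute {a} {b} {c} {d} ab#cd k = begin
    transpose a b (transpose c d k)
      ≡⟨ transpose-conjugate (transpose a b) (transpose-injective a b) c d k ⟩
    transpose (transpose a b c) (transpose a b d) (transpose a b k)
      ≡⟨ cong₂ (λ c′ d′ → transpose c′ d′ (transpose a b k)) (fixes (inj₁ refl)) (fixes (inj₂ refl)) ⟩
    transpose c d (transpose a b k)
      ∎
    where
    open ≡-Reasoning
    fixes : ∀ {x} → x ∈ᵗ (c , d) → transpose a b x ≡ x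
    fixes = transpose-fixes-disjoint (Disjointᵗ-sym ab#cd)

  _≈ᵗ_ : Fin n × Fin n → Fin n × Fin n → Set
  (i , j) ≈ᵗ (k , l) = (i ≡ k × j ≡ l) ⊎ (i ≡ l × j ≡ k)

  ≈ᵗ-refl : ∀ {t} → t ≈ᵗ t
  ≈ᵗ-refl = inj₁ (refl , refl)

  ≈ᵗ-sym : ∀ {s t} → s ≈ᵗ t → t ≈ᵗ s
  ≈ᵗ-sym (inj₁ (refl , refl)) = inj₁ (refl , refl)
  ≈ᵗ-sym (inj₂ (refl , refl)) = inj₂ (refl , refl)

  ≈ᵗ-trans : ∀ {s t u} → s ≈ᵗ t → t ≈ᵗ u → s ≈ᵗ u
  ≈ᵗ-trans (inj₁ (refl , refl)) t≈u                  = t≈u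
  ≈ᵗ-trans (inj₂ (refl , refl)) (inj₁ (refl , refl)) = inj₂ (refl , refl)
  ≈ᵗ-trans (inj₂ (refl , refl)) (inj₂ (refl , refl)) = inj₁ (refl , refl)

  _≈ᵗ?_ : (s t : Fin n × Fin n) → Dec (s ≈ᵗ t)
  (i , j) ≈ᵗ? (k , l) = ((i ≟ k) ×-dec (j ≟ l)) ⊎-dec ((i ≟ l) ×-dec (j ≟ k))

  ≈ᵗ-decSetoid : DecSetoid _ _
  ≈ᵗ-decSetoid = record
    { Carrier = Fin n × Fin n
    ; _≈_ = _≈ᵗ_
    ; isDecEquivalence = record
      { isEquivalence = record { refl = ≈ᵗ-refl ; sym = ≈ᵗ-sym ; trans = ≈ᵗ-trans }
      ; _≟_ = _≈ᵗ?_ } }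

  ∈ᵗ-resp-≈ᵗ : ∀ {s t x} → s ≈ᵗ t → x ∈ᵗ s → x ∈ᵗ t
  ∈ᵗ-resp-≈ᵗ (inj₁ (refl , refl)) x∈s        = x∈s
  ∈ᵗ-resp-≈ᵗ (inj₂ (refl , refl)) (inj₁ x≡i) = inj₂ x≡i
  ∈ᵗ-resp-≈ᵗ (inj₂ (refl , refl)) (inj₂ x≡j) = inj₁ x≡j

  Disjointᵗ-resp-≈ᵗ : ∀ {s s′ t t′} → s ≈ᵗ s′ → t ≈ᵗ t′ → Disjointᵗ s t → Disjointᵗ s′ t′
  Disjointᵗ-resp-≈ᵗ s≈s′ t≈t′ s#t x∈s′ x∈t′ = s#t (∈ᵗ-resp-≈ᵗ (≈ᵗ-sym s≈s′) x∈s′) (∈ᵗ-resp-≈ᵗ (≈ᵗ-sym t≈t′) x∈t′)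

  Disjointᵗ⇒≉ᵗ : ∀ {s t} → Disjointᵗ s t → ¬ s ≈ᵗ t
  Disjointᵗ⇒≉ᵗ s#t s≈t = s#t (inj₁ refl) (∈ᵗ-resp-≈ᵗ s≈t (inj₁ refl))

  Distinctᵗ : Transpositions n → Set
  Distinctᵗ = AllPairs (λ s t → ¬ s ≈ᵗ t)

  GT-Edge-sym : ∀ {F : Transpositions n} {x y} → GT-Edge F x y → GT-Edge F y x
  GT-Edge-sym (inj₁ m) = inj₂ m
  GT-Edge-sym (inj₂ m) = inj₁ m

  GT-Edge⇒≈ᵗ : ∀ {F : Transpositions n} {x y} → GT-Edge F x y → Σ _ λ t → t ∈ F × t ≈ᵗ (x , y)
  GT-Edge⇒≈ᵗ (inj₁ m) = _ , m , inj₁ (refl , refl)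
  GT-Edge⇒≈ᵗ (inj₂ m) = _ , m , inj₂ (refl , refl)

lookup-extensionality : ∀ {A : Set} {m} {u v : Vec A m} → (∀ k → lookup u k ≡ lookup v k) → u ≡ v
lookup-extensionality {u = u} {v} eq =
  trans (sym (tabulate∘lookup u)) (trans (tabulate-cong eq) (tabulate∘lookup v))

module _ {n : ℕ} where

  lookup-·swap : (g : Vec (Fin n) n) (i j k : Fin n) → lookup (g ·swap (i , j)) k ≡ lookup g (transpose i j k)
  lookup-·swap g i j = lookup∘tabulate _

  lookup-·swap-≡ : (g : Vec (Fin n) n) {i j p p′ : Fin n} → transpose i j p ≡ p′ →
                   lookup (g ·swap (i , j)) p ≡ lookup g p′
  lookup-·swap-≡ g {i} {j} {p} eq = trans (lookup-·swap g i j p) (cong (lookup g) eq)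

  lookup-·swap-other : (g : Vec (Fin n) n) {i j p : Fin n} → ¬ p ∈ᵗ (i , j) →
                       lookup (g ·swap (i , j)) p ≡ lookup g p
  lookup-·swap-other g p∉ = lookup-·swap-≡ g (transpose-other (p∉ ∘ inj₁) (p∉ ∘ inj₂))

  ·swap-involutive : (g : Vec (Fin n) n) (t : Fin n × Fin n) → (g ·swap t) ·swap t ≡ g
  ·swap-involutive g (i , j) = lookup-extensionality λ k → begin
    lookup ((g ·swap (i , j)) ·swap (i , j)) k    ≡⟨ lookup-·swap (g ·swap (i , j)) i j k ⟩
    lookup (g ·swap (i , j)) (transpose i j k)    ≡⟨ lookup-·swap g i j _ ⟩
    lookup g (transpose i j (transpose i j k))    ≡⟨ cong (lookup g) (transpose-involutive i j k) ⟩
    lookup g k                                    ∎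
    where open ≡-Reasoning

  ·swap-commute : (g : Vec (Fin n) n) {s t : Fin n × Fin n} → Disjointᵗ s t →
                  (g ·swap s) ·swap t ≡ (g ·swap t) ·swap s
  ·swap-commute g {a , b} {c , d} ab#cd = lookup-extensionality λ k → begin
    lookup ((g ·swap (a , b)) ·swap (c , d)) k    ≡⟨ lookup-·swap (g ·swap (a , b)) c d k ⟩
    lookup (g ·swap (a , b)) (transpose c d k)    ≡⟨ lookup-·swap g a b _ ⟩
    lookup g (transpose a b (transpose c d k))    ≡⟨ cong (lookup g) (transpose-commute ab#cd k) ⟩
    lookup g (transpose c d (transpose a b k))    ≡⟨ lookup-·swap g c d _ ⟨
    lookup (g ·swap (c , d)) (transpose a b k)    ≡⟨ lookup-·swap (g ·swap (c , d)) a b k ⟨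
    lookup ((g ·swap (c , d)) ·swap (a , b)) k    ∎
    where open ≡-Reasoning

  ·swap-resp-≈ᵗ : (g : Vec (Fin n) n) {s t : Fin n × Fin n} → s ≈ᵗ t → g ·swap s ≡ g ·swap t
  ·swap-resp-≈ᵗ g (inj₁ (refl , refl))          = refl
  ·swap-resp-≈ᵗ g {i , j} (inj₂ (refl , refl)) = tabulate-cong (cong (lookup g) ∘ transpose-sym i j)

  ·swap-preserves-IsPerm : ∀ {g : Vec (Fin n) n} t → IsPerm g → IsPerm (g ·swap t)
  ·swap-preserves-IsPerm {g} (i , j) g-perm x y eq =
    transpose-injective i j (g-perm _ _ (trans (sym (lookup-·swap g i j x)) (trans eq (lookup-·swap g i j y))))

  allFin-IsPerm : IsPerm (allFin n)
  allFin-IsPerm x y eq = trans (sym (lookup-allFin x)) (trans eq (lookup-allFin y))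

module _ {A : Set} where

  Linked-++⁻ʳ : ∀ {R : A → A → Set} (xs : List A) {ys} → Linked R (xs ++ ys) → Linked R ys
  Linked-++⁻ʳ []       linked = linked
  Linked-++⁻ʳ (x ∷ xs) linked = Linked-++⁻ʳ xs (Linked.tail linked)

  Unique-++⁻ʳ : (xs : List A) {ys : List A} → Unique (xs ++ ys) → Unique ys
  Unique-++⁻ʳ []       unique       = unique
  Unique-++⁻ʳ (x ∷ xs) (_ ∷ unique) = Unique-++⁻ʳ xs unique

  Linked-∷ʳ : ∀ {R : A → A → Set} (xs : List A) {y z} →
              Linked R (xs ++ y ∷ []) → R y z → Linked R ((xs ++ y ∷ []) ++ z ∷ [])
  Linked-∷ʳ []            [-]        r = r ∷ [-]
  Linked-∷ʳ (x ∷ [])      (r′ ∷ [-]) r = r′ ∷ r ∷ [-]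
  Linked-∷ʳ (x ∷ x′ ∷ xs) (r′ ∷ l)   r = r′ ∷ Linked-∷ʳ (x′ ∷ xs) l r

  Linked-zip : ∀ {R : A → A → Set} a xs w {p} →
               Linked R (a ∷ xs ++ w ∷ []) → p ∈ zip (a ∷ xs) (xs ++ w ∷ []) → R (proj₁ p) (proj₂ p)
  Linked-zip a []       w (r ∷ [-])    (here refl) = r
  Linked-zip a (x ∷ xs) w (r ∷ linked) (here refl) = r
  Linked-zip a (x ∷ xs) w (r ∷ linked) (there p∈) = Linked-zip x xs w linked p∈

  IsCycle-mono : ∀ {E E′ : A → A → Set} {P c} → (∀ {x y} → E x y → E′ x y) → IsCycle E P c → IsCycle E′ P c
  IsCycle-mono {c = []}    _      (_ , _ , _ , ())
  IsCycle-mono {c = _ ∷ _} E⇒E′ (long , unique , inside , walk) = long , unique , inside , Linked.map E⇒E′ walk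

  edge-of-cycle : ∀ {E : A → A → Set} {P c x y} → IsCycle E P c → EdgeOfCycle c x y → E x y ⊎ E y x
  edge-of-cycle {c = []}    (_ , _ , _ , ())
  edge-of-cycle {c = z ∷ c} (_ , _ , _ , walk) (inj₁ xy∈) = inj₁ (Linked-zip z c z walk xy∈)
  edge-of-cycle {c = z ∷ c} (_ , _ , _ , walk) (inj₂ yx∈) = inj₂ (Linked-zip z c z walk yx∈)

module _ {V : Set} (_≟ᵥ_ : DecidableEquality V) {R : V → V → Set} where

  open DecMembership _≟ᵥ_ using (_∈?_)

  SimplePath : V → V → List V → Set
  SimplePath x y ws = Linked R (x ∷ ws ++ y ∷ []) × Unique (x ∷ ws ++ y ∷ [])

  walk⇒simplePath : ∀ {x y} → Star R x y → x ≡ y ⊎ ∃ (SimplePath x y)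
  walk⇒simplePath ε = inj₁ refl
  walk⇒simplePath {x} {y} (r ◅ walk) with x ≟ᵥ y | walk⇒simplePath walk
  ... | yes x≡y | _         = inj₁ x≡y
  ... | no x≢y  | inj₁ refl = inj₂ ([] , r ∷ [-] , (x≢y ∷ []) ∷ [] ∷ [])
  ... | no x≢y  | inj₂ (ws , linked , unique) with x ∈? (_ ∷ ws)
  ...   | no x∉ = inj₂ (_ ∷ ws , r ∷ linked , ¬Any⇒All¬ _ x∉path ∷ unique)
    where
    x∉path : x ∉ (_ ∷ ws ++ y ∷ [])
    x∉path x∈ with ∈-++⁻ (_ ∷ ws) x∈
    ... | inj₁ x∈ws       = x∉ x∈ws
    ... | inj₂ (here x≡y) = x≢y x≡y
  -- x recurs on the path: keep the part from x on
  ...   | yes x∈ with ∈-∃++ x∈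
  ...     | pre , post , split =
    inj₂ (post , Linked-++⁻ʳ pre (subst (Linked R) split′ linked) , Unique-++⁻ʳ pre (subst Unique split′ unique))
    where
    split′ : _ ∷ ws ++ y ∷ [] ≡ pre ++ x ∷ post ++ y ∷ []
    split′ = trans (cong (_++ y ∷ []) split) (++-assoc pre (x ∷ post) (y ∷ []))

-- A graph on n vertices without cycles has fewer than n edges

module _ {n : ℕ} where

  HasCycle : Transpositions n → Set
  HasCycle F = ∃ (IsCycle (GT-Edge F) AllVertices)

  GT-Edge-mono : ∀ {F G : Transpositions n} → (∀ {t} → t ∈ F → t ∈ G) → ∀ {x y} → GT-Edge F x y → GT-Edge G x y
  GT-Edge-mono F⊆G (inj₁ xy∈) = inj₁ (F⊆G xy∈)
  GT-Edge-mono F⊆G (inj₂ yx∈) = inj₂ (F⊆G yx∈)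

  cycle-through-new-edge : ∀ {P : Transpositions n} {x y} → x ≢ y → All (λ t → ¬ (x , y) ≈ᵗ t) P →
                           Star (GT-Edge P) x y → HasCycle ((x , y) ∷ P)
  cycle-through-new-edge {x = x} {y} x≢y fresh walk with walk⇒simplePath _≟_ walk
  ... | inj₁ x≡y = ⊥-elim (x≢y x≡y)
  ... | inj₂ ([] , edge ∷ [-] , _) with GT-Edge⇒≈ᵗ edge
  ...   | _ , t∈P , t≈xy = ⊥-elim (All.lookup fresh t∈P (≈ᵗ-sym t≈xy))
  cycle-through-new-edge {x = x} {y} x≢y fresh walk
      | inj₂ (w ∷ ws , linked , unique) =
    x ∷ w ∷ ws ++ y ∷ [] ,
    s≤s (s≤s (subst (1 ≤_) (sym (length-++ ws)) (m≤n+m 1 (length ws)))) ,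
    unique ,
    All.universal _ _ ,
    Linked-∷ʳ (x ∷ w ∷ ws) (Linked.map (GT-Edge-mono there) linked) (inj₂ (here refl))

  record Components (F : Transpositions n) : Set where
    field
      label        : Fin n → Fin n
      labels       : Subset n
      label∈labels : ∀ x → label x ∈ₛ labels
      connected    : ∀ x y → label x ≡ label y → Star (GT-Edge F) x y
      size         : ∣ labels ∣ + length F ≤ n

  discrete : Components []
  discrete = record
    { label        = id
    ; labels       = ⊤
    ; label∈labels = λ _ → ∈⊤
    ; connected    = λ { x .x refl → ε }
    ; size         = ≤-reflexive (trans (+-identityʳ _) (∣⊤∣≡n n))
    }

  merge : ∀ {P x₀ y₀} (C : Components P) → Components.label C x₀ ≢ Components.label C y₀ →
          Components ((x₀ , y₀) ∷ P)
  merge {P} {x₀} {y₀} C lx≢ly = record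
    { label        = label′
    ; labels       = labels - label y₀
    ; label∈labels = label′∈labels′
    ; connected    = connected′
    ; size         = size′
    }
    where
    open Components C

    label′ : Fin n → Fin n
    label′ z with label z ≟ label y₀
    ... | yes _ = label x₀
    ... | no _  = label z

    label′∈labels′ : ∀ z → label′ z ∈ₛ labels - label y₀
    label′∈labels′ z with label z ≟ label y₀
    ... | yes _ = x∈p∧x≢y⇒x∈p-y (label∈labels x₀) lx≢ly
    ... | no lz≢ly = x∈p∧x≢y⇒x∈p-y (label∈labels z) lz≢ly

    weaken : ∀ {x y} → Star (GT-Edge P) x y → Star (GT-Edge ((x₀ , y₀) ∷ P)) x y
    weaken = Star.map (GT-Edge-mono there)

    connected′ : ∀ x y → label′ x ≡ label′ y → Star (GT-Edge ((x₀ , y₀) ∷ P)) x y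
    connected′ x y eq with label x ≟ label y₀ | label y ≟ label y₀
    ... | yes lx | yes ly = weaken (connected x y (trans lx (sym ly)))
    ... | yes lx | no _   = weaken (connected x y₀ lx) ◅◅ (inj₂ (here refl) ◅ weaken (connected x₀ y eq))
    ... | no _   | yes ly = weaken (connected x x₀ eq) ◅◅ (inj₁ (here refl) ◅ weaken (connected y₀ y (sym ly)))
    ... | no _   | no _   = weaken (connected x y eq)

    size′ : ∣ labels - label y₀ ∣ + suc (length P) ≤ n
    size′ = begin
      ∣ labels - label y₀ ∣ + suc (length P)  ≡⟨ +-suc _ (length P) ⟩
      suc ∣ labels - label y₀ ∣ + length P    ≤⟨ +-monoˡ-≤ (length P) (x∈p⇒∣p-x∣<∣p∣ (label∈labels y₀)) ⟩
      ∣ labels ∣ + length P                   ≤⟨ size ⟩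
      n                                       ∎
      where open ≤-Reasoning

  components-or-cycle : (F : Transpositions n) → Distinctᵗ F → ValidTranspositions F → Components F ⊎ HasCycle F
  components-or-cycle [] _ _ = inj₁ discrete
  components-or-cycle ((x₀ , y₀) ∷ P) (fresh ∷ distinct) (x₀≢y₀ ∷ valid) with components-or-cycle P distinct valid
  ... | inj₂ (c , cycle) = inj₂ (c , IsCycle-mono (GT-Edge-mono there) cycle)
  ... | inj₁ C with Components.label C x₀ ≟ Components.label C y₀
  ...   | yes same      = inj₂ (cycle-through-new-edge x₀≢y₀ fresh (Components.connected C x₀ y₀ same))
  ...   | no different  = inj₁ (merge C different)

  acyclic⇒length<n : ∀ {F : Transpositions n} → Distinctᵗ F → ValidTranspositions F → ¬ HasCycle F →
                     Fin n → length F < n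
  acyclic⇒length<n {F} distinct valid acyclic v with components-or-cycle F distinct valid
  ... | inj₂ cycle = ⊥-elim (acyclic cycle)
  ... | inj₁ C     = ≤-trans (+-monoˡ-≤ (length F) nonempty) size
    where
    open Components C
    nonempty : 1 ≤ ∣ labels ∣
    nonempty = ≤-trans (s≤s z≤n) (x∈p⇒∣p-x∣<∣p∣ (label∈labels v))

module _ {n : ℕ} (s t : Fin n × Fin n) where

  Other : Fin n × Fin n → Set
  Other u = ¬ u ≈ᵗ s × ¬ u ≈ᵗ t

  other? : (u : Fin n × Fin n) → Dec (Other u)
  other? u = ¬? (u ≈ᵗ? s) ×-dec ¬? (u ≈ᵗ? t)

  others : Transpositions n → Transpositions n
  others 𝒯 = deduplicate _≈ᵗ?_ (filter other? 𝒯)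

  ∈-others⁻ : ∀ {𝒯 u} → u ∈ others 𝒯 → u ∈ 𝒯 × Other u
  ∈-others⁻ {𝒯} u∈ = ∈-filter⁻ other? (∈-deduplicate⁻ _≈ᵗ?_ (filter other? 𝒯) u∈)

  others-cover : ∀ {𝒯 u} → u ∈ 𝒯 → u ≈ᵗ s ⊎ u ≈ᵗ t ⊎ Any (u ≈ᵗ_) (others 𝒯)
  others-cover {𝒯} {u} u∈ with u ≈ᵗ? s | u ≈ᵗ? t
  ... | yes u≈s | _       = inj₁ u≈s
  ... | no _    | yes u≈t = inj₂ (inj₁ u≈t)
  ... | no u≉s  | no u≉t  =
    inj₂ (inj₂ (Any.deduplicate⁺ _≈ᵗ?_ (λ v≈w u≈w → ≈ᵗ-trans u≈w (≈ᵗ-sym v≈w))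
                  (Any.map (λ { refl → ≈ᵗ-refl }) (∈-filter⁺ other? u∈ (u≉s , u≉t)))))

  others-distinct : ∀ 𝒯 → Distinctᵗ (others 𝒯)
  others-distinct 𝒯 = deduplicate-! ≈ᵗ-decSetoid (filter other? 𝒯)

  -- t together with the others spans a forest, since every cycle of G(𝒯) uses the edge s
  others-length : ∀ {𝒯} → ValidTranspositions 𝒯 → t ∈ 𝒯 → Disjointᵗ s t →
                  (∀ c → IsCycle (GT-Edge 𝒯) AllVertices c → EdgeOfCycle c (proj₁ s) (proj₂ s)) →
                  2 + length (others 𝒯) ≤ n
  others-length {𝒯} valid t∈ s#t through-s =
    acyclic⇒length<n distinct (All.tabulate (All.lookup valid ∘ F⊆𝒯)) acyclic (proj₁ t)
    where
    F : Transpositions n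
    F = t ∷ others 𝒯

    F⊆𝒯 : ∀ {u} → u ∈ F → u ∈ 𝒯
    F⊆𝒯 (here refl) = t∈
    F⊆𝒯 (there u∈)  = proj₁ (∈-others⁻ {𝒯} u∈)

    distinct : Distinctᵗ F
    distinct = All.tabulate (λ u∈ t≈u → proj₂ (proj₂ (∈-others⁻ {𝒯} u∈)) (≈ᵗ-sym t≈u)) ∷ others-distinct 𝒯

    avoids-s : ∀ {u} → u ∈ F → ¬ u ≈ᵗ s
    avoids-s (here refl) = Disjointᵗ⇒≉ᵗ (Disjointᵗ-sym s#t)
    avoids-s (there u∈)  = proj₁ (proj₂ (∈-others⁻ {𝒯} u∈))

    acyclic : ¬ HasCycle F
    acyclic (c , cycle) =
      let s-on-c       = through-s c (IsCycle-mono (GT-Edge-mono F⊆𝒯) cycle)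
          u , u∈ , u≈s = GT-Edge⇒≈ᵗ ([ id , GT-Edge-sym ]′ (edge-of-cycle cycle s-on-c))
      in avoids-s u∈ u≈s

-- Two 4-cycles of Cay(Sym(n), 𝒯) separated by few vertices

length-cartesianProductWith : ∀ {A B C : Set} (f : A → B → C) xs ys →
                              length (cartesianProductWith f xs ys) ≡ length xs * length ys
length-cartesianProductWith f []       ys = refl
length-cartesianProductWith f (x ∷ xs) ys =
  trans (length-++ (map (f x) ys)) (cong₂ _+_ (length-map (f x) ys) (length-cartesianProductWith f xs ys))

module SquareCut {n : ℕ} (𝒯 : Transpositions n) (a b c d : Fin n)
  (ab∈𝒯 : (a , b) ∈ 𝒯) (cd∈𝒯 : (c , d) ∈ 𝒯) (a≢b : a ≢ b) (c≢d : c ≢ d)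
  (ab#cd : Disjointᵗ (a , b) (c , d)) where

  V : Set
  V = Vec (Fin n) n

  t₁ t₂ : Fin n × Fin n
  t₁ = a , b
  t₂ = c , d

  a≢c : a ≢ c
  a≢c a≡c = ab#cd (inj₁ refl) (inj₁ a≡c)

  a≢d : a ≢ d
  a≢d a≡d = ab#cd (inj₁ refl) (inj₂ a≡d)

  b≢c : b ≢ c
  b≢c b≡c = ab#cd (inj₂ refl) (inj₁ b≡c)

  square : V → List V
  square g = g ∷ g ·swap t₁ ∷ (g ·swap t₁) ·swap t₂ ∷ g ·swap t₂ ∷ []

  swap₁₂₁ : ∀ g → ((g ·swap t₁) ·swap t₂) ·swap t₁ ≡ g ·swap t₂
  swap₁₂₁ g = trans (·swap-commute (g ·swap t₁) (Disjointᵗ-sym ab#cd)) (cong (_·swap t₂) (·swap-involutive g t₁))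

  square-closed₁ : ∀ {g x} → x ∈ square g → x ·swap t₁ ∈ square g
  square-closed₁     (here refl)                         = there (here refl)
  square-closed₁ {g} (there (here refl))                 = here (·swap-involutive g t₁)
  square-closed₁ {g} (there (there (here refl)))         = there (there (there (here (swap₁₂₁ g))))
  square-closed₁ {g} (there (there (there (here refl)))) = there (there (here (·swap-commute g (Disjointᵗ-sym ab#cd))))

  square-closed₂ : ∀ {g x} → x ∈ square g → x ·swap t₂ ∈ square g
  square-closed₂     (here refl)                         = there (there (there (here refl)))
  square-closed₂     (there (here refl))                 = there (there (here refl))
  square-closed₂ {g} (there (there (here refl)))         = there (here (·swap-involutive (g ·swap t₁) t₂))
  square-closed₂ {g} (there (there (there (here refl)))) = here (·swap-involutive g t₂)

  square-all : ∀ {P : V → Set} → (∀ {x} → P x → P (x ·swap t₁)) → (∀ {x} → P x → P (x ·swap t₂)) →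
               ∀ {g} → P g → All P (square g)
  square-all P₁ P₂ Pg = Pg ∷ P₁ Pg ∷ P₂ (P₁ Pg) ∷ P₂ Pg ∷ []

  square-IsPerm : ∀ g → IsPerm g → All IsPerm (square g)
  square-IsPerm g =
    square-all {IsPerm} (λ {x} → ·swap-preserves-IsPerm {g = x} t₁) (λ {x} → ·swap-preserves-IsPerm {g = x} t₂) {g}

  square-unique : ∀ {g} → IsPerm g → Unique (square g)
  square-unique {g} g-perm =
      (differ-at a refl g₁-a a≢b ∷ differ-at a refl g₁₂-a a≢b ∷ differ-at c refl g₂-c c≢d ∷ [])
    ∷ (differ-at c g₁-c g₁₂-c c≢d ∷ differ-at a g₁-a g₂-a (a≢b ∘ sym) ∷ [])
    ∷ (differ-at a g₁₂-a g₂-a (a≢b ∘ sym) ∷ [])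
    ∷ [] ∷ []
    where
    differ-at : ∀ {x y} p {u v} → lookup x p ≡ lookup g u → lookup y p ≡ lookup g v → u ≢ v → x ≢ y
    differ-at p xp yp u≢v refl = u≢v (g-perm _ _ (trans (sym xp) yp))

    g₁ = g ·swap t₁
    fixed₁ : ∀ {x} → x ∈ᵗ t₂ → transpose a b x ≡ x
    fixed₁ = transpose-fixes-disjoint (Disjointᵗ-sym ab#cd)
    fixed₂ : ∀ {x} → x ∈ᵗ t₁ → transpose c d x ≡ x
    fixed₂ = transpose-fixes-disjoint ab#cd

    g₁-a : lookup g₁ a ≡ lookup g b
    g₁-a = lookup-·swap-≡ g (transpose-matchˡ a b)
    g₁-c : lookup g₁ c ≡ lookup g c
    g₁-c = lookup-·swap-≡ g (fixed₁ (inj₁ refl))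
    g₂-a : lookup (g ·swap t₂) a ≡ lookup g a
    g₂-a = lookup-·swap-≡ g (fixed₂ (inj₁ refl))
    g₂-c : lookup (g ·swap t₂) c ≡ lookup g d
    g₂-c = lookup-·swap-≡ g (transpose-matchˡ c d)
    g₁₂-a : lookup (g₁ ·swap t₂) a ≡ lookup g b
    g₁₂-a = trans (lookup-·swap-≡ g₁ (fixed₂ (inj₁ refl))) g₁-a
    g₁₂-c : lookup (g₁ ·swap t₂) c ≡ lookup g d
    g₁₂-c = trans (lookup-·swap-≡ g₁ (transpose-matchˡ c d)) (lookup-·swap-≡ g (fixed₁ (inj₂ refl)))

  square-component : ∀ {P g} → IsPerm g → All P (square g) → ComponentHasCycle (Cay-Edge 𝒯) P g
  square-component {P} {g} g-perm inside@(Pg ∷ Pg₁ ∷ Pg₁₂ ∷ Pg₂ ∷ []) =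
    square g ,
    (s≤s (s≤s (s≤s z≤n)) , square-unique g-perm , inside ,
     (t₁ , ab∈𝒯 , refl) ∷ (t₂ , cd∈𝒯 , refl) ∷
     (t₁ , ab∈𝒯 , sym (swap₁₂₁ g)) ∷ (t₂ , cd∈𝒯 , sym (·swap-involutive g t₂)) ∷ [-]) ,
    (Pg , ε) ∷
    (Pg , g→g₁ ◅ ε) ∷
    (Pg , g→g₁ ◅ (Pg₁ , Pg₁₂ , t₂ , cd∈𝒯 , refl) ◅ ε) ∷
    (Pg , (Pg , Pg₂ , t₂ , cd∈𝒯 , refl) ◅ ε) ∷ []
    where
    g→g₁ : Restrict (Cay-Edge 𝒯) P g (g ·swap t₁)
    g→g₁ = Pg , Pg₁ , t₁ , ab∈𝒯 , refl

  MapsInto : (Fin n → Set) → (Fin n → Set) → V → Set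
  MapsInto X Y x = ∀ {p} → X p → Y (lookup x p)

  record Sends (Y Z : Fin n → Set) (x : V) : Set where
    constructor sends
    field
      sends₁ : MapsInto (_∈ᵗ t₁) Y x
      sends₂ : MapsInto (_∈ᵗ t₂) Z x

  Preserves Exchanges : V → Set
  Preserves = Sends (_∈ᵗ t₁) (_∈ᵗ t₂)
  Exchanges = Sends (_∈ᵗ t₂) (_∈ᵗ t₁)

  MapsInto-·swap : ∀ {X Y g i j} → (∀ {p} → X p → X (transpose i j p)) →
                   MapsInto X Y g → MapsInto X Y (g ·swap (i , j))
  MapsInto-·swap {Y = Y} {g} {i} {j} closed g↦ {p} Xp = subst Y (sym (lookup-·swap g i j p)) (g↦ (closed Xp))

  Sends-·swap₁ : ∀ {Y Z x} → Sends Y Z x → Sends Y Z (x ·swap t₁)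
  Sends-·swap₁ {Y} {Z} {x} (sends x↦₁ x↦₂) =
    sends (MapsInto-·swap {_∈ᵗ t₁} {Y} {x} ∈ᵗ-transpose-self x↦₁)
          (MapsInto-·swap {_∈ᵗ t₂} {Z} {x} (∈ᵗ-transpose-disjoint (Disjointᵗ-sym ab#cd)) x↦₂)

  Sends-·swap₂ : ∀ {Y Z x} → Sends Y Z x → Sends Y Z (x ·swap t₂)
  Sends-·swap₂ {Y} {Z} {x} (sends x↦₁ x↦₂) =
    sends (MapsInto-·swap {_∈ᵗ t₁} {Y} {x} (∈ᵗ-transpose-disjoint ab#cd) x↦₁)
          (MapsInto-·swap {_∈ᵗ t₂} {Z} {x} ∈ᵗ-transpose-self x↦₂)

  ¬Preserves×Exchanges : ∀ {x} → Preserves x → Exchanges x → ⊥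
  ¬Preserves×Exchanges (sends x↦₁ _) (sends x↦₂ _) = ab#cd (x↦₁ (inj₁ refl)) (x↦₂ (inj₁ refl))

  -- q and q ·swap (i , j) agree off i and j, in particular on one of a, b, c
  exchanges-not-adjacent : ∀ {q x} → Preserves q → Exchanges x → ∀ i j → x ≢ q ·swap (i , j)
  exchanges-not-adjacent {q} (sends q↦₁ q↦₂) (sends x↦₂ x↦₁) i j refl
    with a ∈ᵗ? (i , j) | b ∈ᵗ? (i , j) | c ∈ᵗ? (i , j)
  ... | no a∉  | _      | _      = ab#cd (q↦₁ (inj₁ refl)) (subst (_∈ᵗ t₂) (lookup-·swap-other q a∉) (x↦₂ (inj₁ refl)))
  ... | yes _  | no b∉  | _      = ab#cd (q↦₁ (inj₂ refl)) (subst (_∈ᵗ t₂) (lookup-·swap-other q b∉) (x↦₂ (inj₂ refl)))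
  ... | yes _  | yes _  | no c∉  = ab#cd (subst (_∈ᵗ t₁) (lookup-·swap-other q c∉) (x↦₁ (inj₁ refl))) (q↦₂ (inj₁ refl))
  ... | yes a∈ | yes b∈ | yes c∈ = three-endpoints a≢b a≢c b≢c a∈ b∈ c∈

  identity exchange : V
  identity = allFin n
  exchange = (identity ·swap (a , c)) ·swap (b , d)

  identity-preserves : Preserves identity
  identity-preserves =
    sends (λ {p} → subst (_∈ᵗ t₁) (sym (lookup-allFin p))) (λ {p} → subst (_∈ᵗ t₂) (sym (lookup-allFin p)))

  exchange-exchanges : Exchanges exchange
  exchange-exchanges = sends
    (λ { (inj₁ refl) → inj₁ (at (transpose-other a≢b a≢d) (transpose-matchˡ a c))
       ; (inj₂ refl) → inj₂ (at (transpose-matchˡ b d) (transpose-other (a≢d ∘ sym) (c≢d ∘ sym))) })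
    (λ { (inj₁ refl) → inj₁ (at (transpose-other (b≢c ∘ sym) c≢d) (transpose-matchʳ a c))
       ; (inj₂ refl) → inj₂ (at (transpose-matchʳ b d) (transpose-other (a≢b ∘ sym) b≢c)) })
    where
    at : ∀ {p p′ p″} → transpose b d p ≡ p′ → transpose a c p′ ≡ p″ → lookup exchange p ≡ p″
    at eq₁ eq₂ =
      trans (lookup-·swap-≡ (identity ·swap (a , c)) eq₁) (trans (lookup-·swap-≡ identity eq₂) (lookup-allFin _))

  exchange-IsPerm : IsPerm exchange
  exchange-IsPerm =
    ·swap-preserves-IsPerm {g = identity ·swap (a , c)} (b , d)
      (·swap-preserves-IsPerm {g = identity} (a , c) (allFin-IsPerm {n}))

  inner outer : List V
  inner = square identity
  outer = square exchange

  _≟ᵥ_ : DecidableEquality V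
  _≟ᵥ_ = ≡-dec _≟_

  open DecMembership _≟ᵥ_ using (_∈?_)

  neighbours : List V
  neighbours = cartesianProductWith _·swap_ inner (others t₁ t₂ 𝒯)

  outside? : (x : V) → Dec (x ∉ inner)
  outside? x = ¬? (x ∈? inner)

  cut : List V
  cut = filter outside? (deduplicate _≟ᵥ_ neighbours)

  ∈-cut⁻ : ∀ {x} → x ∈ cut → (∃₂ λ q u → q ∈ inner × u ∈ others t₁ t₂ 𝒯 × x ≡ q ·swap u) × x ∉ inner
  ∈-cut⁻ x∈ with ∈-filter⁻ outside? {xs = deduplicate _≟ᵥ_ neighbours} x∈
  ... | x∈dedup , x∉ =
    ∈-cartesianProductWith⁻ _·swap_ inner (others t₁ t₂ 𝒯) (∈-deduplicate⁻ _≟ᵥ_ neighbours x∈dedup) , x∉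

  ∈-cut⁺ : ∀ {q u} → q ∈ inner → u ∈ others t₁ t₂ 𝒯 → q ·swap u ∉ inner → q ·swap u ∈ cut
  ∈-cut⁺ q∈ u∈ x∉ = ∈-filter⁺ outside? (∈-deduplicate⁺ _≟ᵥ_ (∈-cartesianProductWith⁺ _·swap_ q∈ u∈)) x∉

  length-cut : length cut ≤ 4 * length (others t₁ t₂ 𝒯)
  length-cut = begin
    length cut                            ≤⟨ length-filter outside? (deduplicate _≟ᵥ_ neighbours) ⟩
    length (deduplicate _≟ᵥ_ neighbours)  ≤⟨ length-deduplicate _≟ᵥ_ neighbours ⟩
    length neighbours                     ≡⟨ length-cartesianProductWith _·swap_ inner (others t₁ t₂ 𝒯) ⟩
    4 * length (others t₁ t₂ 𝒯)           ∎
    where open ≤-Reasoning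

  inner-IsPerm : All IsPerm inner
  inner-IsPerm = square-IsPerm identity (allFin-IsPerm {n})

  cut-IsPerm : All IsPerm cut
  cut-IsPerm = All.tabulate (neighbour-IsPerm ∘ proj₁ ∘ ∈-cut⁻)
    where
    neighbour-IsPerm : ∀ {x} → (∃₂ λ q u → q ∈ inner × u ∈ others t₁ t₂ 𝒯 × x ≡ q ·swap u) → IsPerm x
    neighbour-IsPerm (q , u , q∈ , _ , refl) = ·swap-preserves-IsPerm {g = q} u (All.lookup inner-IsPerm q∈)

  inner-preserves : All Preserves inner
  inner-preserves = square-all {Preserves} Sends-·swap₁ Sends-·swap₂ identity-preserves

  outer-exchanges : All Exchanges outer
  outer-exchanges = square-all {Exchanges} Sends-·swap₁ Sends-·swap₂ exchange-exchanges

  G-cut : V → Set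
  G-cut = Minus IsPerm cut

  inner-survives : All G-cut inner
  inner-survives = All.tabulate λ x∈ → All.lookup inner-IsPerm x∈ , λ x∈cut → proj₂ (∈-cut⁻ x∈cut) x∈

  outer-survives : All G-cut outer
  outer-survives = All.tabulate λ x∈ → All.lookup (square-IsPerm exchange exchange-IsPerm) x∈ , outer∉cut x∈
    where
    outer∉cut : ∀ {x} → x ∈ outer → x ∉ cut
    outer∉cut x∈ x∈cut with ∈-cut⁻ x∈cut
    ... | (q , (i , j) , q∈ , _ , refl) , _ =
      exchanges-not-adjacent {q} (All.lookup inner-preserves q∈) (All.lookup outer-exchanges x∈) i j refl

  inner-closed : ∀ {x y} → x ∈ inner → Restrict (Cay-Edge 𝒯) G-cut x y → y ∈ inner
  inner-closed {x} x∈ (_ , (_ , y∉cut) , u , u∈𝒯 , refl) with others-cover t₁ t₂ u∈𝒯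
  ... | inj₁ u≈t₁         = subst (_∈ inner) (sym (·swap-resp-≈ᵗ x u≈t₁)) (square-closed₁ x∈)
  ... | inj₂ (inj₁ u≈t₂)  = subst (_∈ inner) (sym (·swap-resp-≈ᵗ x u≈t₂)) (square-closed₂ x∈)
  ... | inj₂ (inj₂ u≈other) with find u≈other
  ...   | u′ , u′∈ , u≈u′ rewrite ·swap-resp-≈ᵗ x u≈u′ with x ·swap u′ ∈? inner
  ...     | yes y∈ = y∈
  ...     | no y∉  = ⊥-elim (y∉cut (∈-cut⁺ x∈ u′∈ y∉))

  inner-component : ∀ {x y} → Star (Restrict (Cay-Edge 𝒯) G-cut) x y → x ∈ inner → y ∈ inner
  inner-component ε            x∈ = x∈
  inner-component (step ◅ walk) x∈ = inner-component walk (inner-closed x∈ step)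

  cyclicConnectivity≤ : CyclicConnectivity≤ (Cay-Edge 𝒯) IsPerm (4 * length (others t₁ t₂ 𝒯))
  cyclicConnectivity≤ =
    cut ,
    (filter⁺ outside? (DecUnique.deduplicate-! _≟ᵥ_ neighbours) ,
     cut-IsPerm ,
     identity , exchange , All.head inner-survives , All.head outer-survives ,
     (λ (_ , walk) →
        ¬Preserves×Exchanges (All.lookup inner-preserves (inner-component walk (here refl))) exchange-exchanges) ,
     square-component (allFin-IsPerm {n}) inner-survives , square-component exchange-IsPerm outer-survives) ,
    length-cut

module _ {n : ℕ} where

  EdgeOfCycle-resp-≈ᵗ : ∀ {c : List (Fin n)} {i j k l} → (i , j) ≈ᵗ (k , l) → EdgeOfCycle c i j → EdgeOfCycle c k l
  EdgeOfCycle-resp-≈ᵗ (inj₁ (refl , refl)) e = e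
  EdgeOfCycle-resp-≈ᵗ (inj₂ (refl , refl)) e = Sum.swap e

  -- the edges c₀c₁ and c₂c₃ of the cycle c₀c₁c₂c₃…
  opposite-cycle-edges : ∀ {𝒯 : Transpositions n} → UnicyclicTriangleFree 𝒯 →
    ∃₂ λ s t → s ∈ 𝒯 × t ∈ 𝒯 × Disjointᵗ s t ×
      (∀ c → IsCycle (GT-Edge 𝒯) AllVertices c → EdgeOfCycle c (proj₁ s) (proj₂ s))
  opposite-cycle-edges (_ , [] , (_ , _ , _ , ()) , _)
  opposite-cycle-edges (_ , _ ∷ [] , _ , s≤s () , _)
  opposite-cycle-edges (_ , _ ∷ _ ∷ [] , _ , s≤s (s≤s ()) , _)
  opposite-cycle-edges (_ , _ ∷ _ ∷ _ ∷ [] , _ , s≤s (s≤s (s≤s ())) , _)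
  opposite-cycle-edges
    (_ , c₀ ∷ c₁ ∷ c₂ ∷ c₃ ∷ _ ,
     (_ , (_ ∷ c₀≢c₂ ∷ c₀≢c₃ ∷ _) ∷ (c₁≢c₂ ∷ c₁≢c₃ ∷ _) ∷ _ , _ , e₀₁ ∷ _ ∷ e₂₃ ∷ _) , _ , unicyclic)
    with GT-Edge⇒≈ᵗ e₀₁ | GT-Edge⇒≈ᵗ e₂₃
  ... | (a , b) , ab∈ , ab≈ | (c , d) , cd∈ , cd≈ =
    (a , b) , (c , d) , ab∈ , cd∈ ,
    Disjointᵗ-resp-≈ᵗ (≈ᵗ-sym ab≈) (≈ᵗ-sym cd≈) (disjointᵗ c₀≢c₂ c₀≢c₃ c₁≢c₂ c₁≢c₃) ,
    λ cycle is-cycle → EdgeOfCycle-resp-≈ᵗ {c = cycle} (≈ᵗ-sym ab≈)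
                         (Equivalence.to (unicyclic cycle is-cycle c₀ c₁) (inj₁ (here refl)))

CyclicConnectivity≤-mono : ∀ {V : Set} {E : V → V → Set} {P : V → Set} {k m} →
                           k ≤ m → CyclicConnectivity≤ E P k → CyclicConnectivity≤ E P m
CyclicConnectivity≤-mono k≤m (S , cyclic , |S|≤k) = S , cyclic , ≤-trans |S|≤k k≤m

2+m≤n⇒4*m≤4*n∸8 : ∀ {m n} → 2 + m ≤ n → 4 * m ≤ 4 * n ∸ 8
2+m≤n⇒4*m≤4*n∸8 {m} {n} 2+m≤n = begin
  4 * m             ≡⟨ m+n∸m≡n 8 (4 * m) ⟨
  8 + 4 * m ∸ 8     ≡⟨ cong (_∸ 8) (*-distribˡ-+ 4 2 m) ⟨
  4 * (2 + m) ∸ 8   ≤⟨ ∸-monoˡ-≤ 8 (*-monoʳ-≤ 4 2+m≤n) ⟩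
  4 * n ∸ 8         ∎
  where open ≤-Reasoning

-- the hypothesis 4 ≤ n is implied by the cycle of length at least 4
lemma3p1 : (n : ℕ) → 4 ≤ n → (𝒯 : Transpositions n) →
    ValidTranspositions 𝒯 → UnicyclicTriangleFree 𝒯 →
    CyclicConnectivity≤ (Cay-Edge 𝒯) IsPerm (4 * n ∸ 8)
lemma3p1 n _ 𝒯 valid unicyclic with opposite-cycle-edges unicyclic
... | (a , b) , (c , d) , ab∈𝒯 , cd∈𝒯 , ab#cd , every-cycle-uses-ab =
  CyclicConnectivity≤-mono
    (2+m≤n⇒4*m≤4*n∸8 (others-length (a , b) (c , d) valid cd∈𝒯 ab#cd every-cycle-uses-ab))
    (SquareCut.cyclicConnectivity≤ 𝒯 a b c d ab∈𝒯 cd∈𝒯 (All.lookup valid ab∈𝒯) (All.lookup valid cd∈𝒯) ab#cd)
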